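{- $\operatorname{TD}\equiv_{\mathrm{W}}\widehat{\operatorname{TD}}$, where $\widehat{\operatorname{TD}}$ is the parallelization of the pruning derivative $\operatorname{TD}:\mathbb{AT}\to\mathbb{AT}$.
   Context: Notation: $\langle\cdot,\cdot\rangle$ is a standard computable pairing on $\mathbb{N}$; $(p)_n(k)=p(\langle n,k\rangle)$. For nonempty $s$, $\overleftarrow{s}$ is the $t$ with $s=\langle n\rangle^\frown t$. A concrete (labeled) tree is $(T,\phi)$ with $T\subseteq\mathbb{N}^{<\mathbb{N}}$ a tree and $\phi:T\setminus\{\langle\rangle\}\to\mathbb{N}$, $T$ empty or with at least two elements. Coding: $X_0=\{p:\forall k\,((p)_k(0)=0\Rightarrow(p)_k=0^\omega)\}$, $X_{n+1}=\{p\in X_n:\forall k\,((p)_k(0)\neq0\Rightarrow\overleftarrow{(p)_k}\in X_n)\}$, $\mathrm{dom}(\delta_{\mathbb{CT}})=\bigcap_nX_n$. A nonempty $\sigma$ is a path through $p$ if $(p)_{\sigma(0)}(0)\neq0$ and, if $|\sigma|>1$, $\overleftarrow\sigma$ is a path through $\overleftarrow{(p)_{\sigma(0)}}$; its encoded label is $(p)_{\sigma(0)}(0)-1$ if $|\sigma|=1$, else the encoded label of $\overleftarrow\sigma$ in $\overleftarrow{(p)_{\sigma(0)}}$. $\delta_{\mathbb{CT}}(p)=(T,\phi)$ with $T$ = paths through $p$ plus $\langle\rangle$ if $p\neq0^\omega$, $T=\emptyset$ if $p=0^\omega$, $\phi$ = encoded labels. Concrete trees $(T_0,\phi_0),(T_1,\phi_1)$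 are bisimilar if $T_0=T_1=\emptyset$ or there is $Z\subseteq T_0\times T_1$ with $\langle\rangle Z\langle\rangle$ such that whenever $\sigma Z\tau$: $|\sigma|=|\tau|$, $\phi_0(\sigma)=\phi_1(\tau)$ if $\sigma\neq\langle\rangle$, each child of $\sigma$ is $Z$-related to a child of $\tau$ and vice versa. $\mathbb{AT}$ is the represented space of abstract trees (bisimilarity classes) with $\delta_{\mathbb{AT}}(p)=[\delta_{\mathbb{CT}}(p)]$. The pruning derivative $\operatorname{TD}(T)$ of a tree $T$ is the subtree consisting of those nodes whose subtrees (in $T$) have infinite height; on a concrete tree $(T,\phi)$ it is $(\operatorname{TD}(T),\phi|_{\operatorname{TD}(T)})$, and it respects bisimilarity, giving $\operatorname{TD}:\mathbb{AT}\to\mathbb{AT}$. Parallelization: for $f:\subseteq\mathbf{X}\rightrightarrows\mathbf{Y}$, $\widehat{f}:\subseteq\mathbf{X}^\mathbb{N}\rightrightarrows\mathbf{Y}^\mathbb{N}$ maps $(x_n)_n$ (with all $x_n\in\mathrm{dom}(f)$) to all $(y_n)_n$ with $y_n\in f(x_n)$, where a sequence is represented by $p$ with $(p)_n$ a name of the $n$-th term. Weihrauch reducibility: represented spaces $(X,\delta_X)$ with partial surjections $\delta_X:\subseteq\mathbb{N}^\mathbb{N}\to X$; $F\vdash f$ if $\delta_Y(F(p))\in f(\delta_X(p))$ for all $p\in\mathrm{dom}(f\delta_X)$; $f\leq_{\mathrm{W}}g$ if there are computable $K:\subseteq\mathbb{N}^\mathbb{N}\times\mathbb{N}^\mathbb{N}\to\mathbb{N}^\mathbb{N}$,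 $H:\subseteq\mathbb{N}^\mathbb{N}\to\mathbb{N}^\mathbb{N}$ such that $p\mapsto K(p,G(H(p)))$ realizes $f$ for every $G\vdash g$; $\equiv_{\mathrm{W}}$ is the induced equivalence. -}

module Defs where

open import Data.Nat using (ℕ; zero; suc; _+_; _∸_; _≤_; _<_)
open import Data.Fin using (Fin)
open import Data.Vec using (Vec; []; _∷_; lookup)
open import Data.List using (List; []; _∷_; _++_; length; [_])
open import Data.Product using (Σ; _×_; _,_)
open import Data.Sum using (_⊎_)
open import Data.Empty using (⊥)
open import Relation.Nullary using (¬_)
open import Relation.Binary.PropositionalEquality using (_≡_; _≢_)

Baire : Set
Baire = ℕ → ℕ

tri : ℕ → ℕ
tri zero    = zero
tri (suc m) = suc m + tri m

pair : ℕ → ℕ → ℕ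
pair n k = tri (n + k) + k

sub : Baire → ℕ → Baire
sub p n k = p (pair n k)

tl : Baire → Baire
tl p k = p (suc k)

join : Baire → Baire → Baire
join p q zero          = p 0
join p q (suc zero)    = q 0
join p q (suc (suc n)) = join (tl p) (tl q) n

data PR : ℕ → Set where
  zeroF : ∀ {n} → PR n
  succF : PR 1
  projF : ∀ {n} → Fin n → PR n
  orcF  : PR 1
  compF : ∀ {n m} → PR m → Vec (PR n) m → PR n
  precF : ∀ {n} → PR n → PR (suc (suc n)) → PR (suc n)
  muF   : ∀ {n} → PR (suc n) → PR n

data _⊢_∙_⇓_ (α : Baire) : ∀ {n} → PR n → Vec ℕ n → ℕ → Set
data _⊢_∙_⇓*_ (α : Baire) : ∀ {n m} → Vec (PR n) m → Vec ℕ n → Vec ℕ m → Set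

data _⊢_∙_⇓_ α where
  zeroE : ∀ {n} {xs : Vec ℕ n} → α ⊢ zeroF ∙ xs ⇓ 0
  succE : ∀ {x} → α ⊢ succF ∙ (x ∷ []) ⇓ suc x
  projE : ∀ {n} {i : Fin n} {xs} → α ⊢ projF i ∙ xs ⇓ lookup xs i
  orcE  : ∀ {x} → α ⊢ orcF ∙ (x ∷ []) ⇓ α x
  compE : ∀ {n m} {f : PR m} {gs : Vec (PR n) m} {xs ys v} →
          α ⊢ gs ∙ xs ⇓* ys → α ⊢ f ∙ ys ⇓ v → α ⊢ compF f gs ∙ xs ⇓ v
  prec0 : ∀ {n} {f : PR n} {g xs v} →
          α ⊢ f ∙ xs ⇓ v → α ⊢ precF f g ∙ (0 ∷ xs) ⇓ v
  precS : ∀ {n} {f : PR n} {g y xs u v} →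
          α ⊢ precF f g ∙ (y ∷ xs) ⇓ u → α ⊢ g ∙ (y ∷ u ∷ xs) ⇓ v →
          α ⊢ precF f g ∙ (suc y ∷ xs) ⇓ v
  muE   : ∀ {n} {f : PR (suc n)} {xs y} →
          α ⊢ f ∙ (y ∷ xs) ⇓ 0 →
          (∀ z → z < y → Σ ℕ (λ w → α ⊢ f ∙ (z ∷ xs) ⇓ suc w)) →
          α ⊢ muF f ∙ xs ⇓ y

data _⊢_∙_⇓*_ α where
  []E  : ∀ {n} {xs : Vec ℕ n} → α ⊢ [] ∙ xs ⇓* []
  _∷E_ : ∀ {n m} {g : PR n} {gs : Vec (PR n) m} {xs y ys} →
         α ⊢ g ∙ xs ⇓ y → α ⊢ gs ∙ xs ⇓* ys → α ⊢ (g ∷ gs) ∙ xs ⇓* (y ∷ ys)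

-- the computable partial map Baire → Baire with code e (e^p(n) = q(n))
-- is defined on p with value q
Computes : PR 1 → Baire → Baire → Set
Computes e p q = ∀ n → p ⊢ e ∙ (n ∷ []) ⇓ q n

Xn : ℕ → Baire → Set
Xn zero    p = ∀ k → sub p k 0 ≡ 0 → ∀ j → sub p k j ≡ 0
Xn (suc n) p = Xn n p × (∀ k → sub p k 0 ≢ 0 → Xn n (tl (sub p k)))

DomCT : Baire → Set
DomCT p = ∀ n → Xn n p

IsPath : List ℕ → Baire → Set
IsPath []            p = ⊥
IsPath (n ∷ [])      p = sub p n 0 ≢ 0
IsPath (n ∷ m ∷ σ)   p = sub p n 0 ≢ 0 × IsPath (m ∷ σ) (tl (sub p n))

label : List ℕ → Baire → ℕ
label []          p = 0
label (n ∷ [])    p = sub p n 0 ∸ 1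
label (n ∷ m ∷ σ) p = label (m ∷ σ) (tl (sub p n))

record CTree : Set₁ where
  field
    T   : List ℕ → Set
    lab : List ℕ → ℕ
open CTree public

IsZero : Baire → Set
IsZero p = ∀ k → p k ≡ 0

δCT : Baire → CTree
δCT p = record
  { T   = λ σ → ¬ IsZero p × (σ ≡ [] ⊎ IsPath σ p)
  ; lab = λ σ → label σ p }

EmptyT : CTree → Set
EmptyT t = ∀ σ → ¬ T t σ

record Bisimulation (t₀ t₁ : CTree) (Z : List ℕ → List ℕ → Set) : Set where
  field
    inT    : ∀ σ τ → Z σ τ → T t₀ σ × T t₁ τ
    root   : Z [] []
    len    : ∀ σ τ → Z σ τ → length σ ≡ length τ
    labEq  : ∀ σ τ → Z σ τ → σ ≢ [] → lab t₀ σ ≡ lab t₁ τ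
    forth  : ∀ σ τ → Z σ τ → ∀ n → T t₀ (σ ++ [ n ]) →
             Σ ℕ (λ m → T t₁ (τ ++ [ m ]) × Z (σ ++ [ n ]) (τ ++ [ m ]))
    back   : ∀ σ τ → Z σ τ → ∀ m → T t₁ (τ ++ [ m ]) →
             Σ ℕ (λ n → T t₀ (σ ++ [ n ]) × Z (σ ++ [ n ]) (τ ++ [ m ]))

Bisim : CTree → CTree → Set₁
Bisim t₀ t₁ = (EmptyT t₀ × EmptyT t₁)
            ⊎ Σ (List ℕ → List ℕ → Set) (Bisimulation t₀ t₁)

InfHeight : CTree → List ℕ → Set
InfHeight t σ = ∀ h → Σ (List ℕ) (λ τ → h ≤ length τ × T t (σ ++ τ))

Core : CTree → List ℕ → Set
Core t σ = T t σ × InfHeight t σ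

-- nodes of infinite height; if only the root survives the result is the
-- empty tree (a one-node tree is not a concrete tree)
TD : CTree → CTree
TD t = record
  { T   = λ σ → Core t σ × Σ ℕ (λ n → Core t [ n ])
  ; lab = lab t }

record Problem : Set₂ where
  field
    Dom : Baire → Set                 -- p ∈ dom(f ∘ δ_X)
    Sol : Baire → Baire → Set₁        -- δ_Y(q) ∈ f(δ_X(p))
open Problem public

Realizes : Problem → (Baire → Baire) → Set₁
Realizes g G = ∀ p → Dom g p → Sol g p (G p)

_≤W_ : Problem → Problem → Set₁
f ≤W g = Σ (PR 1) λ eH → Σ (PR 1) λ eK →
  ∀ (G : Baire → Baire) → Realizes g G →
  ∀ p → Dom f p →
  Σ Baire λ q → Computes eH p q × Dom g q ×
  Σ Baire λ r → Computes eK (join p (G q)) r × Sol f p r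

_≡W_ : Problem → Problem → Set₁
f ≡W g = (f ≤W g) × (g ≤W f)

TDprob : Problem
TDprob = record
  { Dom = DomCT
  ; Sol = λ p q → DomCT q × Bisim (δCT q) (TD (δCT p)) }

TDhat : Problem
TDhat = record
  { Dom = λ p → ∀ n → DomCT (sub p n)
  ; Sol = λ p q → ∀ n → DomCT (sub q n) ×
                        Bisim (δCT (sub q n)) (TD (δCT (sub p n))) }

-- Both reductions are strong: the backward map only sees the answer.  TD reduces to its
-- parallelization by asking for TD of the constant sequence and keeping the first answer.
-- Conversely, a sequence (T_n) is glued into a single tree whose root has, for every n, a child
-- labelled n carrying T_n.  A node of the glued tree below the root child n has infinite height
-- exactly when the corresponding node of T_n does, so in any tree bisimilar to the pruned glued
-- tree the root children labelled n, together with all their children, yield a tree bisimilar to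
-- TD(T_n).  Both maps need only pairing, unpairing and a test for equality, all primitive
-- recursive relative to the oracle.

module Submission where

open import Defs
open import Data.Nat using (ℕ; zero; suc; _+_; _∸_; _≤_; _<_; s≤s; pred; ∣_-_∣; _≟_)
open import Data.Nat.Properties
open import Data.Fin using (#_)
open import Data.Vec using (Vec; []; _∷_; lookup; head)
open import Data.List using (List; []; _∷_; _++_; length; [_])
open import Data.List.Properties using (length-++)
open import Data.Product using (Σ; _×_; _,_; proj₁; proj₂)
open import Data.Sum using (_⊎_; inj₁; inj₂; map₂)
open import Data.Empty using (⊥; ⊥-elim)
open import Data.Unit using (⊤; tt)
open import Function using (_∘_)
open import Relation.Nullary using (¬_; yes; no)
open import Relation.Binary.PropositionalEquality hiding ([_])

Functional : ℕ → Set
Functional n = Baire → Vec ℕ n → ℕ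

Computable : ∀ {n} → Functional n → Set
Computable {n} f = Σ (PR n) λ e → ∀ α xs → α ⊢ e ∙ xs ⇓ f α xs

private
  variable
    n : ℕ
    f g h : Functional n

Computable-resp : (∀ α xs → f α xs ≡ g α xs) → Computable f → Computable g
Computable-resp f≡g (e , ⇓f) = e , λ α xs → subst (α ⊢ e ∙ xs ⇓_) (f≡g α xs) (⇓f α xs)

zeroᶜ : Computable {n} (λ _ _ → 0)
zeroᶜ = zeroF , λ _ _ → zeroE

projᶜ : ∀ i → Computable {n} (λ _ xs → lookup xs i)
projᶜ i = projF i , λ _ _ → projE

compose₁ : {f : Functional 1} → Computable f → Computable g →
           Computable (λ α xs → f α (g α xs ∷ []))
compose₁ (e , ⇓f) (e₁ , ⇓g) = compF e (e₁ ∷ []) , λ α xs → compE (⇓g α xs ∷E []E) (⇓f α _)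

compose₂ : {f : Functional 2} → Computable f → Computable g → Computable h →
           Computable (λ α xs → f α (g α xs ∷ h α xs ∷ []))
compose₂ (e , ⇓f) (e₁ , ⇓g) (e₂ , ⇓h) =
  compF e (e₁ ∷ e₂ ∷ []) , λ α xs → compE (⇓g α xs ∷E (⇓h α xs ∷E []E)) (⇓f α _)

primRec : Functional n → Functional (suc (suc n)) → Functional (suc n)
primRec f g α (zero  ∷ xs) = f α xs
primRec f g α (suc y ∷ xs) = g α (y ∷ primRec f g α (y ∷ xs) ∷ xs)

primRecᶜ : Computable f → Computable g → Computable (primRec f g)
primRecᶜ {f = f} {g = g} (e , ⇓f) (e′ , ⇓g) = precF e e′ , ⇓
  where
  ⇓ : ∀ α xs → α ⊢ precF e e′ ∙ xs ⇓ primRec f g α xs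
  ⇓ α (zero  ∷ xs) = prec0 (⇓f α xs)
  ⇓ α (suc y ∷ xs) = precS (⇓ α (y ∷ xs)) (⇓g α _)

argᶜ : Computable {1} (λ _ xs → head xs)
argᶜ = Computable-resp (λ { _ (x ∷ []) → refl }) (projᶜ (# 0))

sucᶜ : Computable f → Computable (λ α xs → suc (f α xs))
sucᶜ = compose₁ successor
  where
  successor : Computable {1} (λ _ xs → suc (head xs))
  successor = succF , λ { _ (x ∷ []) → succE }

oracleᶜ : Computable f → Computable (λ α xs → α (f α xs))
oracleᶜ = compose₁ query
  where
  query : Computable {1} (λ α xs → α (head xs))
  query = orcF , λ { _ (x ∷ []) → orcE }

_+ᶜ_ : Computable f → Computable g → Computable (λ α xs → f α xs + g α xs)
_+ᶜ_ = compose₂ plus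
  where
  plus≡ : ∀ α xs → primRec (λ _ xs → lookup xs (# 0)) (λ _ xs → suc (lookup xs (# 1))) α xs
                 ≡ head xs + lookup xs (# 1)
  plus≡ α (zero  ∷ b ∷ []) = refl
  plus≡ α (suc a ∷ b ∷ []) = cong suc (plus≡ α (a ∷ b ∷ []))
  plus : Computable {2} (λ _ xs → head xs + lookup xs (# 1))
  plus = Computable-resp plus≡ (primRecᶜ (projᶜ (# 0)) (sucᶜ (projᶜ (# 1))))

_∸ᶜ_ : Computable f → Computable g → Computable (λ α xs → f α xs ∸ g α xs)
_∸ᶜ_ = compose₂ monus
  where
  predecessor : Computable {1} (λ _ xs → pred (head xs))
  predecessor = Computable-resp (λ { _ (zero ∷ []) → refl ; _ (suc a ∷ []) → refl })
                                (primRecᶜ zeroᶜ (projᶜ (# 0)))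
  countdown : ∀ α y x → primRec (λ _ xs → lookup xs (# 0)) (λ _ xs → pred (lookup xs (# 1)))
                                α (y ∷ x ∷ []) ≡ x ∸ y
  countdown α zero    x = refl
  countdown α (suc y) x = trans (cong pred (countdown α y x)) (pred[m∸n]≡m∸[1+n] x y)
  monus : Computable {2} (λ _ xs → head xs ∸ lookup xs (# 1))
  monus = Computable-resp (λ { α (a ∷ b ∷ []) → countdown α b a })
            (compose₂ (primRecᶜ (projᶜ (# 0)) (compose₁ predecessor (projᶜ (# 1))))
                      (projᶜ (# 1)) (projᶜ (# 0)))

triᶜ : Computable f → Computable (λ α xs → tri (f α xs))
triᶜ = compose₁ triangle
  where
  tri≡ : ∀ α xs → primRec (λ _ _ → 0) (λ _ xs → suc (lookup xs (# 0)) + lookup xs (# 1)) α xs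
                ≡ tri (head xs)
  tri≡ α (zero  ∷ []) = refl
  tri≡ α (suc m ∷ []) = cong (suc m +_) (tri≡ α (m ∷ []))
  triangle : Computable {1} (λ _ xs → tri (head xs))
  triangle = Computable-resp tri≡ (primRecᶜ zeroᶜ (sucᶜ (projᶜ (# 0)) +ᶜ projᶜ (# 1)))

pairᶜ : Computable f → Computable g → Computable (λ α xs → pair (f α xs) (g α xs))
pairᶜ F G = triᶜ (F +ᶜ G) +ᶜ G

whenZero : ℕ → ℕ → ℕ
whenZero zero    v = v
whenZero (suc _) v = 0

ifEqual : ℕ → ℕ → ℕ → ℕ
ifEqual a b v = whenZero ∣ a - b ∣ v

ifEqual-≡ : ∀ {a b} v → a ≡ b → ifEqual a b v ≡ v
ifEqual-≡ {a} v refl rewrite ∣n-n∣≡0 a = refl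

ifEqual-≢ : ∀ {a b} v → a ≢ b → ifEqual a b v ≡ 0
ifEqual-≢ {a} {b} v a≢b with ∣ a - b ∣ in eq
... | zero  = ⊥-elim (a≢b (∣m-n∣≡0⇒m≡n eq))
... | suc _ = refl

m∸1≡n⇒m≡1+n : ∀ {m n} → m ≢ 0 → m ∸ 1 ≡ n → m ≡ suc n
m∸1≡n⇒m≡1+n {zero}  m≢0 _    = ⊥-elim (m≢0 refl)
m∸1≡n⇒m≡1+n {suc m} _   refl = refl

∣m-n∣≡[m∸n]+[n∸m] : ∀ m n → ∣ m - n ∣ ≡ (m ∸ n) + (n ∸ m)
∣m-n∣≡[m∸n]+[n∸m] zero    zero    = refl
∣m-n∣≡[m∸n]+[n∸m] zero    (suc n) = refl
∣m-n∣≡[m∸n]+[n∸m] (suc m) zero    = sym (+-identityʳ (suc m))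
∣m-n∣≡[m∸n]+[n∸m] (suc m) (suc n) = ∣m-n∣≡[m∸n]+[n∸m] m n

ifEqualᶜ : Computable f → Computable g → Computable h →
           Computable (λ α xs → ifEqual (f α xs) (g α xs) (h α xs))
ifEqualᶜ {f = f} {g = g} F G H =
  compose₂ whenZeroᶜ (Computable-resp distance≡ ((F ∸ᶜ G) +ᶜ (G ∸ᶜ F))) H
  where
  distance≡ : ∀ α xs → (f α xs ∸ g α xs) + (g α xs ∸ f α xs) ≡ ∣ f α xs - g α xs ∣
  distance≡ α xs = sym (∣m-n∣≡[m∸n]+[n∸m] (f α xs) (g α xs))
  whenZeroᶜ : Computable {2} (λ _ xs → whenZero (head xs) (lookup xs (# 1)))
  whenZeroᶜ = Computable-resp (λ { _ (zero ∷ v ∷ []) → refl ; _ (suc t ∷ v ∷ []) → refl })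
                              (primRecᶜ (projᶜ (# 0)) zeroᶜ)

diagonalStep : ℕ → ℕ → ℕ
diagonalStep x s = s + ifEqual (suc x) (tri (suc s)) 1

diagonal : ℕ → ℕ
diagonal zero    = 0
diagonal (suc x) = diagonalStep x (diagonal x)

unpair₂ : ℕ → ℕ
unpair₂ x = x ∸ tri (diagonal x)

unpair₁ : ℕ → ℕ
unpair₁ x = diagonal x ∸ unpair₂ x

tri-suc : ∀ s → tri (suc s) ≡ suc (tri s + s)
tri-suc s = cong suc (+-comm s (tri s))

diagonal-tri+ : ∀ s k → k ≤ s → diagonal (tri s + k) ≡ s
diagonal-tri+ zero    zero _ = refl
diagonal-tri+ (suc s) zero _ = begin
  diagonal (tri (suc s) + 0)                       ≡⟨ cong diagonal (trans (+-identityʳ _) (tri-suc s)) ⟩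
  diagonalStep (tri s + s) (diagonal (tri s + s))  ≡⟨ cong (diagonalStep (tri s + s)) (diagonal-tri+ s s ≤-refl) ⟩
  s + ifEqual (suc (tri s + s)) (tri (suc s)) 1    ≡⟨ cong (s +_) (ifEqual-≡ 1 (sym (tri-suc s))) ⟩
  s + 1                                            ≡⟨ +-comm s 1 ⟩
  suc s                                            ∎
  where open ≡-Reasoning
diagonal-tri+ s (suc k) k<s = begin
  diagonal (tri s + suc k)                         ≡⟨ cong diagonal (+-suc (tri s) k) ⟩
  diagonalStep (tri s + k) (diagonal (tri s + k))  ≡⟨ cong (diagonalStep (tri s + k)) (diagonal-tri+ s k (<⇒≤ k<s)) ⟩
  s + ifEqual (suc (tri s + k)) (tri (suc s)) 1    ≡⟨ cong (s +_) (ifEqual-≢ 1 (<⇒≢ before-next)) ⟩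
  s + 0                                            ≡⟨ +-identityʳ s ⟩
  s                                                ∎
  where
  open ≡-Reasoning
  before-next : suc (tri s + k) < tri (suc s)
  before-next = subst (suc (tri s + k) <_) (sym (tri-suc s)) (s≤s (+-monoʳ-< (tri s) k<s))

diagonal-pair : ∀ n k → diagonal (pair n k) ≡ n + k
diagonal-pair n k = diagonal-tri+ (n + k) k (m≤n+m k n)

unpair₂-pair : ∀ n k → unpair₂ (pair n k) ≡ k
unpair₂-pair n k rewrite diagonal-pair n k = m+n∸m≡n (tri (n + k)) k

unpair₁-pair : ∀ n k → unpair₁ (pair n k) ≡ n
unpair₁-pair n k = trans (cong₂ _∸_ (diagonal-pair n k) (unpair₂-pair n k)) (m+n∸n≡m n k)

diagonalᶜ : Computable f → Computable (λ α xs → diagonal (f α xs))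
diagonalᶜ = compose₁ (Computable-resp diagonal≡ (primRecᶜ zeroᶜ stepᶜ))
  where
  stepᶜ : Computable {2} (λ _ xs → diagonalStep (lookup xs (# 0)) (lookup xs (# 1)))
  stepᶜ = projᶜ (# 1) +ᶜ ifEqualᶜ (sucᶜ (projᶜ (# 0))) (triᶜ (sucᶜ (projᶜ (# 1)))) (sucᶜ zeroᶜ)
  diagonal≡ : ∀ α xs → primRec (λ _ _ → 0) (λ _ xs → diagonalStep (lookup xs (# 0)) (lookup xs (# 1))) α xs
                     ≡ diagonal (head xs)
  diagonal≡ α (zero  ∷ []) = refl
  diagonal≡ α (suc x ∷ []) = cong (diagonalStep x) (diagonal≡ α (x ∷ []))

unpair₂ᶜ : Computable f → Computable (λ α xs → unpair₂ (f α xs))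
unpair₂ᶜ F = F ∸ᶜ triᶜ (diagonalᶜ F)

unpair₁ᶜ : Computable f → Computable (λ α xs → unpair₁ (f α xs))
unpair₁ᶜ F = diagonalᶜ F ∸ᶜ unpair₂ᶜ F

oddPart : Baire → Baire
oddPart α i = α (suc (i + i))

oddPart-join : ∀ p r → oddPart (join p r) ≗ r
oddPart-join p r zero    = refl
oddPart-join p r (suc i) rewrite +-suc i i = oddPart-join (tl p) (tl r) i

oddPartᶜ : Computable f → Computable (λ α xs → oddPart α (f α xs))
oddPartᶜ F = oracleᶜ (sucᶜ (F +ᶜ F))

ComputableOp : (Baire → Baire) → Set
ComputableOp F = Computable {1} (λ α xs → F α (head xs))

record _≤sW_ (f g : Problem) : Set₁ where
  field
    forward             : Baire → Baire
    backward            : Baire → Baire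
    forward-computable  : ComputableOp forward
    backward-computable : ComputableOp (backward ∘ oddPart)
    backward-resp       : ∀ {r r′} → r ≗ r′ → backward r ≗ backward r′
    forward-dom         : ∀ p → Dom f p → Dom g (forward p)
    -- Quantifying over realizers lets the correctness proof consult g on other instances.
    backward-sol        : ∀ G → Realizes g G → ∀ p → Dom f p → Sol f p (backward (G (forward p)))

≤sW⇒≤W : ∀ {f g} → f ≤sW g → f ≤W g
≤sW⇒≤W reduction = proj₁ forward-computable , proj₁ backward-computable , λ G realizes p p∈dom →
  forward p , (λ k → proj₂ forward-computable p (k ∷ [])) , forward-dom p p∈dom ,
  backward (G (forward p)) , computes-answer G p , backward-sol G realizes p p∈dom
  where
  open _≤sW_ reduction
  computes-answer : ∀ G p → Computes (proj₁ backward-computable) (join p (G (forward p)))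
                                     (backward (G (forward p)))
  computes-answer G p k = subst (_ ⊢ _ ∙ _ ⇓_) (backward-resp (oddPart-join p (G (forward p))) k)
                                (proj₂ backward-computable (join p (G (forward p))) (k ∷ []))

private
  variable
    p p′ : Baire

IsPath-resp : ∀ σ → p ≗ p′ → IsPath σ p → IsPath σ p′
IsPath-resp []          p≗p′ ()
IsPath-resp (n ∷ [])    p≗p′ n∈p            = λ eq → n∈p (trans (p≗p′ _) eq)
IsPath-resp (n ∷ m ∷ σ) p≗p′ (n∈p , σ∈p)    =
  (λ eq → n∈p (trans (p≗p′ _) eq)) , IsPath-resp (m ∷ σ) (λ k → p≗p′ (pair n (suc k))) σ∈p

label-resp : ∀ σ → p ≗ p′ → label σ p ≡ label σ p′
label-resp []          p≗p′ = refl
label-resp (n ∷ [])    p≗p′ = cong (_∸ 1) (p≗p′ _)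
label-resp (n ∷ m ∷ σ) p≗p′ = label-resp (m ∷ σ) (λ k → p≗p′ (pair n (suc k)))

Xn-resp : ∀ j → p ≗ p′ → Xn j p → Xn j p′
Xn-resp zero    p≗p′ x k root≡0 i = trans (sym (p≗p′ _)) (x k (trans (p≗p′ _) root≡0) i)
Xn-resp (suc j) p≗p′ (x , xs) =
  Xn-resp j p≗p′ x ,
  λ k root≢0 → Xn-resp j (λ i → p≗p′ (pair k (suc i))) (xs k (λ eq → root≢0 (trans (sym (p≗p′ _)) eq)))

DomCT-resp : p ≗ p′ → DomCT p → DomCT p′
DomCT-resp p≗p′ p∈dom j = Xn-resp j p≗p′ (p∈dom j)

IsPath⇒nonzero : ∀ σ → IsPath σ p → ¬ IsZero p
IsPath⇒nonzero (n ∷ [])    n∈p       p≡0 = n∈p (p≡0 _)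
IsPath⇒nonzero (n ∷ m ∷ σ) (n∈p , _) p≡0 = n∈p (p≡0 _)

IsPath-head-resp : ∀ c k σ → sub p c ≗ sub p′ k → IsPath (c ∷ σ) p → IsPath (k ∷ σ) p′
IsPath-head-resp c k []      pc≗p′k c∈p           = λ eq → c∈p (trans (pc≗p′k 0) eq)
IsPath-head-resp c k (m ∷ σ) pc≗p′k (c∈p , σ∈pc) =
  (λ eq → c∈p (trans (pc≗p′k 0) eq)) , IsPath-resp (m ∷ σ) (λ i → pc≗p′k (suc i)) σ∈pc

label-head-resp : ∀ c k σ → sub p c ≗ sub p′ k → label (c ∷ σ) p ≡ label (k ∷ σ) p′
label-head-resp c k []      pc≗p′k = cong (_∸ 1) (pc≗p′k 0)
label-head-resp c k (m ∷ σ) pc≗p′k = label-resp (m ∷ σ) (λ i → pc≗p′k (suc i))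

record _≈ₜ_ (t t′ : CTree) : Set where
  field
    nodes→ : ∀ σ → T t σ → T t′ σ
    nodes← : ∀ σ → T t′ σ → T t σ
    labels : ∀ σ → lab t σ ≡ lab t′ σ
open _≈ₜ_

≈ₜ-sym : ∀ {t t′} → t ≈ₜ t′ → t′ ≈ₜ t
≈ₜ-sym t≈t′ = record { nodes→ = nodes← t≈t′ ; nodes← = nodes→ t≈t′ ; labels = λ σ → sym (labels t≈t′ σ) }

δCT-resp : p ≗ p′ → δCT p ≈ₜ δCT p′
δCT-resp {p} {p′} p≗p′ = record
  { nodes→ = transport p≗p′
  ; nodes← = transport (λ k → sym (p≗p′ k))
  ; labels = λ σ → label-resp σ p≗p′ }
  where
  transport : ∀ {a b} → a ≗ b → ∀ σ → T (δCT a) σ → T (δCT b) σ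
  transport a≗b σ (a≢0 , σ∈a) =
    (λ b≡0 → a≢0 (λ k → trans (a≗b k) (b≡0 k))) , map₂ (IsPath-resp σ a≗b) σ∈a

InfHeight-transport : ∀ {t t′} σ σ′ κ → (∀ ρ → T t (σ ++ ρ) → T t′ (σ′ ++ κ ++ ρ)) →
                      InfHeight t σ → InfHeight t′ σ′
InfHeight-transport σ σ′ κ embed ∞ h with ∞ h
... | ρ , h≤|ρ| , σρ∈t = κ ++ ρ , ≤-trans h≤|ρ| |ρ|≤|κρ| , embed ρ σρ∈t
  where
  |ρ|≤|κρ| : length ρ ≤ length (κ ++ ρ)
  |ρ|≤|κρ| = subst (length ρ ≤_) (sym (length-++ κ)) (m≤n+m (length ρ) (length κ))

Core-resp : ∀ {t t′} → t ≈ₜ t′ → ∀ σ → Core t σ → Core t′ σ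
Core-resp {t} {t′} t≈t′ σ (σ∈t , ∞) =
  nodes→ t≈t′ σ σ∈t , InfHeight-transport {t} {t′} σ σ [] (λ ρ → nodes→ t≈t′ (σ ++ ρ)) ∞

Core-child⇒Core-root : ∀ j → Core (δCT p) [ j ] → Core (δCT p) []
Core-child⇒Core-root {p} j ((p≢0 , _) , ∞) =
  (p≢0 , inj₁ refl) , InfHeight-transport {δCT p} {δCT p} [ j ] [] [ j ] (λ _ jρ∈p → jρ∈p) ∞

TD-resp : ∀ {t t′} → t ≈ₜ t′ → TD t ≈ₜ TD t′
TD-resp t≈t′ = record
  { nodes→ = λ σ → map-TD t≈t′ σ
  ; nodes← = λ σ → map-TD (≈ₜ-sym t≈t′) σ
  ; labels = labels t≈t′ }
  where
  map-TD : ∀ {t t′} → t ≈ₜ t′ → ∀ σ → T (TD t) σ → T (TD t′) σ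
  map-TD t≈t′ σ (σ∈core , n , n∈core) = Core-resp t≈t′ σ σ∈core , n , Core-resp t≈t′ [ n ] n∈core

Bisim-sym : ∀ {t s} → Bisim t s → Bisim s t
Bisim-sym (inj₁ (t-empty , s-empty)) = inj₁ (s-empty , t-empty)
Bisim-sym (inj₂ (Z , B)) = inj₂ ((λ τ σ → Z σ τ) , record
  { inT   = λ τ σ z → let (σ∈t , τ∈s) = inT σ τ z in τ∈s , σ∈t
  ; root  = root
  ; len   = λ τ σ z → sym (len σ τ z)
  ; labEq = λ τ σ z τ≢[] → sym (labEq σ τ z (λ σ≡[] → τ≢[] (length≡0 τ (trans (sym (len σ τ z)) (cong length σ≡[])))))
  ; forth = λ τ σ z → back σ τ z
  ; back  = λ τ σ z → forth σ τ z })
  where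
  open Bisimulation B
  length≡0 : ∀ τ → length τ ≡ 0 → τ ≡ []
  length≡0 [] _ = refl

Bisim-respˡ : ∀ {t t′ s} → t ≈ₜ t′ → Bisim t s → Bisim t′ s
Bisim-respˡ t≈t′ (inj₁ (t-empty , s-empty)) = inj₁ ((λ σ σ∈t′ → t-empty σ (nodes← t≈t′ σ σ∈t′)) , s-empty)
Bisim-respˡ t≈t′ (inj₂ (Z , B)) = inj₂ (Z , record
  { inT   = λ σ τ z → let (σ∈t , τ∈s) = inT σ τ z in nodes→ t≈t′ σ σ∈t , τ∈s
  ; root  = root
  ; len   = len
  ; labEq = λ σ τ z σ≢[] → trans (sym (labels t≈t′ σ)) (labEq σ τ z σ≢[])
  ; forth = λ σ τ z n σn∈t′ → forth σ τ z n (nodes← t≈t′ _ σn∈t′)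
  ; back  = λ σ τ z m τm∈s → let (n , σn∈t , zn) = back σ τ z m τm∈s in n , nodes→ t≈t′ _ σn∈t , zn })
  where open Bisimulation B

Bisim-respʳ : ∀ {t s s′} → s ≈ₜ s′ → Bisim t s → Bisim t s′
Bisim-respʳ s≈s′ = Bisim-sym ∘ Bisim-respˡ s≈s′ ∘ Bisim-sym

Bisim-decides-TD : ∀ {x t} → Bisim (δCT x) (TD t) → EmptyT (TD t) ⊎ Σ ℕ (λ j → Core t [ j ])
Bisim-decides-TD (inj₁ (_ , TD-empty)) = inj₁ TD-empty
Bisim-decides-TD (inj₂ (_ , B)) with Bisimulation.inT B [] [] (Bisimulation.root B)
... | _ , (_ , j , j-core) = inj₂ (j , j-core)

constSeq : Baire → Baire
constSeq p x = p (unpair₂ x)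

sub-constSeq : ∀ p n → sub (constSeq p) n ≗ p
sub-constSeq p n k = cong p (unpair₂-pair n k)

TDprob≤sWTDhat : TDprob ≤sW TDhat
TDprob≤sWTDhat = record
  { forward             = constSeq
  ; backward            = λ r → sub r 0
  ; forward-computable  = oracleᶜ (unpair₂ᶜ argᶜ)
  ; backward-computable = oddPartᶜ (pairᶜ zeroᶜ argᶜ)
  ; backward-resp       = λ r≗r′ k → r≗r′ (pair 0 k)
  ; forward-dom         = constSeq-dom
  ; backward-sol        = first-solves }
  where
  constSeq-dom : ∀ p → DomCT p → ∀ n → DomCT (sub (constSeq p) n)
  constSeq-dom p p∈dom n = DomCT-resp (λ k → sym (sub-constSeq p n k)) p∈dom

  first-solves : ∀ G → Realizes TDhat G → ∀ p → DomCT p → Sol TDprob p (sub (G (constSeq p)) 0)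
  first-solves G realizes p p∈dom with realizes (constSeq p) (constSeq-dom p p∈dom) 0
  ... | r₀∈dom , r₀∼TD = r₀∈dom , Bisim-respʳ (TD-resp (δCT-resp (sub-constSeq p 0))) r₀∼TD

glueEntry : Baire → ℕ → ℕ → ℕ
glueEntry P n zero    = suc n
glueEntry P n (suc j) = P (pair n j)

-- (glue P)_n = (n+1) ⌢ (P)_n: the root gets, for every n, a child labelled n carrying the tree named by (P)_n.
glue : Baire → Baire
glue P x = glueEntry P (unpair₁ x) (unpair₂ x)

glueᶜ : ComputableOp glue
glueᶜ = Computable-resp (λ α xs → entry≡ α (unpair₂ (head xs)) (unpair₁ (head xs)))
          (compose₂ (primRecᶜ (sucᶜ (projᶜ (# 0))) (oracleᶜ (pairᶜ (projᶜ (# 2)) (projᶜ (# 0)))))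
                    (unpair₂ᶜ argᶜ) (unpair₁ᶜ argᶜ))
  where
  entry≡ : ∀ α j n → primRec (λ _ xs → suc (lookup xs (# 0))) (λ α xs → α (pair (lookup xs (# 2)) (lookup xs (# 0))))
                             α (j ∷ n ∷ []) ≡ glueEntry α n j
  entry≡ α zero    n = refl
  entry≡ α (suc j) n = refl

glue-root : ∀ P n → sub (glue P) n 0 ≡ suc n
glue-root P n = cong₂ (glueEntry P) (unpair₁-pair n 0) (unpair₂-pair n 0)

glue-root≢0 : ∀ P n → sub (glue P) n 0 ≢ 0
glue-root≢0 P n eq with trans (sym (glue-root P n)) eq
... | ()

tl-glue : ∀ P n → tl (sub (glue P) n) ≗ sub P n
tl-glue P n j = cong₂ (glueEntry P) (unpair₁-pair n (suc j)) (unpair₂-pair n (suc j))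

glue-dom : ∀ P → (∀ n → DomCT (sub P n)) → DomCT (glue P)
glue-dom P P∈dom zero    k root≡0 = ⊥-elim (glue-root≢0 P k root≡0)
glue-dom P P∈dom (suc j) = glue-dom P P∈dom j , λ k _ → Xn-resp j (λ i → sym (tl-glue P k i)) (P∈dom k j)

unglueEntry : Baire → ℕ → ℕ → ℕ → ℕ
unglueEntry g n c z = ifEqual (g (pair (unpair₁ c) 0)) (suc n) (g (pair (unpair₁ c) (suc (pair (unpair₂ c) z))))

-- (unglue g)_n names the tree whose root children c = ⟨m, k⟩ are the children k of those root children m
-- of g that are labelled n, each with the subtree of g below it.
unglue : Baire → Baire
unglue g x = unglueEntry g (unpair₁ x) (unpair₁ (unpair₂ x)) (unpair₂ (unpair₂ x))

unglue-resp : ∀ {g g′} → g ≗ g′ → unglue g ≗ unglue g′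
unglue-resp g≗g′ x = cong₂ (λ a v → ifEqual a _ v) (g≗g′ _) (g≗g′ _)

unglueᶜ : ComputableOp (unglue ∘ oddPart)
unglueᶜ = ifEqualᶜ (oddPartᶜ (pairᶜ mᶜ zeroᶜ)) (sucᶜ nᶜ) (oddPartᶜ (pairᶜ mᶜ (sucᶜ (pairᶜ kᶜ zᶜ))))
  where
  nᶜ : Computable {1} (λ _ xs → unpair₁ (head xs))
  nᶜ = unpair₁ᶜ argᶜ
  cᶜ : Computable {1} (λ _ xs → unpair₁ (unpair₂ (head xs)))
  cᶜ = unpair₁ᶜ (unpair₂ᶜ argᶜ)
  zᶜ : Computable {1} (λ _ xs → unpair₂ (unpair₂ (head xs)))
  zᶜ = unpair₂ᶜ (unpair₂ᶜ argᶜ)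
  mᶜ : Computable {1} (λ _ xs → unpair₁ (unpair₁ (unpair₂ (head xs))))
  mᶜ = unpair₁ᶜ cᶜ
  kᶜ : Computable {1} (λ _ xs → unpair₂ (unpair₁ (unpair₂ (head xs))))
  kᶜ = unpair₂ᶜ cᶜ

module GluedTree (P : Baire) where

  Glued : CTree
  Glued = δCT (glue P)

  Part : ℕ → CTree
  Part n = δCT (sub P n)

  glue-nonzero : ¬ IsZero (glue P)
  glue-nonzero glue≡0 = glue-root≢0 P 0 (glue≡0 (pair 0 0))

  child∈Glued : ∀ n → T Glued [ n ]
  child∈Glued n = glue-nonzero , inj₂ (glue-root≢0 P n)

  Glued→Part : ∀ n j τ → T Glued (n ∷ j ∷ τ) → T (Part n) (j ∷ τ)
  Glued→Part n j τ (_ , inj₁ ())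
  Glued→Part n j τ (_ , inj₂ (_ , jτ∈glue)) = IsPath⇒nonzero (j ∷ τ) jτ∈Pn , inj₂ jτ∈Pn
    where
    jτ∈Pn : IsPath (j ∷ τ) (sub P n)
    jτ∈Pn = IsPath-resp (j ∷ τ) (tl-glue P n) jτ∈glue

  Part→Glued : ∀ n j τ → T (Part n) (j ∷ τ) → T Glued (n ∷ j ∷ τ)
  Part→Glued n j τ (_ , inj₁ ())
  Part→Glued n j τ (_ , inj₂ jτ∈Pn) =
    glue-nonzero , inj₂ (glue-root≢0 P n , IsPath-resp (j ∷ τ) (λ i → sym (tl-glue P n i)) jτ∈Pn)

  Core-Glued→Part : ∀ n j τ → Core Glued (n ∷ j ∷ τ) → Core (Part n) (j ∷ τ)
  Core-Glued→Part n j τ (node , ∞) =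
    Glued→Part n j τ node , InfHeight-transport {Glued} {Part n} (n ∷ j ∷ τ) (j ∷ τ) []
                                                 (λ ρ → Glued→Part n j (τ ++ ρ)) ∞

  Core-Part→Glued : ∀ n j τ → Core (Part n) (j ∷ τ) → Core Glued (n ∷ j ∷ τ)
  Core-Part→Glued n j τ (node , ∞) =
    Part→Glued n j τ node , InfHeight-transport {Part n} {Glued} (j ∷ τ) (n ∷ j ∷ τ) []
                                                 (λ ρ → Part→Glued n j (τ ++ ρ)) ∞

  Core-Part→child : ∀ n j → Core (Part n) [ j ] → Core Glued [ n ]
  Core-Part→child n j (_ , ∞) =
    child∈Glued n , InfHeight-transport {Part n} {Glued} [ j ] [ n ] [ j ] (Part→Glued n j) ∞

  label-child : ∀ n → label [ n ] (glue P) ≡ n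
  label-child n = cong (_∸ 1) (glue-root P n)

  label-Glued : ∀ n j τ → label (n ∷ j ∷ τ) (glue P) ≡ label (j ∷ τ) (sub P n)
  label-Glued n j τ = label-resp (j ∷ τ) (tl-glue P n)

module UngluedTree (g : Baire) (n : ℕ) where

  R : Baire
  R = sub (unglue g) n

  Selected : ℕ → Set
  Selected c = g (pair (unpair₁ c) 0) ≡ suc n

  Grandchild : ℕ → Baire
  Grandchild c = sub (tl (sub g (unpair₁ c))) (unpair₂ c)

  R-entry : ∀ x → R x ≡ unglueEntry g n (unpair₁ x) (unpair₂ x)
  R-entry x rewrite unpair₁-pair n x | unpair₂-pair n x = refl

  sub-R : ∀ c z → sub R c z ≡ unglueEntry g n c z
  sub-R c z = trans (R-entry (pair c z)) (cong₂ (unglueEntry g n) (unpair₁-pair c z) (unpair₂-pair c z))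

  sub-R-selected : ∀ c → Selected c → sub R c ≗ Grandchild c
  sub-R-selected c sel z = trans (sub-R c z) (ifEqual-≡ _ sel)

  sub-R-unselected : ∀ c → ¬ Selected c → ∀ z → sub R c z ≡ 0
  sub-R-unselected c ¬sel z = trans (sub-R c z) (ifEqual-≢ _ ¬sel)

  selected⇒root≢0 : ∀ c → Selected c → sub g (unpair₁ c) 0 ≢ 0
  selected⇒root≢0 c sel eq with trans (sym sel) eq
  ... | ()

  IsPath-R⇒ : ∀ c σ → IsPath (c ∷ σ) R → Selected c × IsPath (unpair₁ c ∷ unpair₂ c ∷ σ) g
  IsPath-R⇒ c σ cσ∈R with g (pair (unpair₁ c) 0) ≟ suc n
  ... | no ¬sel = ⊥-elim (head≢0 σ cσ∈R (sub-R-unselected c ¬sel 0))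
    where
    head≢0 : ∀ σ → IsPath (c ∷ σ) R → sub R c 0 ≢ 0
    head≢0 []      c∈R       = c∈R
    head≢0 (_ ∷ _) (c∈R , _) = c∈R
  ... | yes sel = sel , selected⇒root≢0 c sel , IsPath-head-resp c (unpair₂ c) σ (sub-R-selected c sel) cσ∈R

  IsPath-R⇐ : ∀ c σ → Selected c → IsPath (unpair₁ c ∷ unpair₂ c ∷ σ) g → IsPath (c ∷ σ) R
  IsPath-R⇐ c σ sel (_ , kσ∈g) =
    IsPath-head-resp (unpair₂ c) c σ (λ z → sym (sub-R-selected c sel z)) kσ∈g

  label-R : ∀ c σ → Selected c → label (c ∷ σ) R ≡ label (unpair₁ c ∷ unpair₂ c ∷ σ) g
  label-R c σ sel = label-head-resp c (unpair₂ c) σ (sub-R-selected c sel)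

  R-dom : DomCT g → DomCT R
  R-dom g∈dom zero c root≡0 with g (pair (unpair₁ c) 0) ≟ suc n
  ... | no ¬sel = sub-R-unselected c ¬sel
  ... | yes sel = λ z → trans (sub-R-selected c sel z)
                    (proj₂ (g∈dom 1) (unpair₁ c) (selected⇒root≢0 c sel) (unpair₂ c)
                           (trans (sym (sub-R-selected c sel 0)) root≡0) z)
  R-dom g∈dom (suc j) = R-dom g∈dom j , subtree-dom
    where
    subtree-dom : ∀ c → sub R c 0 ≢ 0 → Xn j (tl (sub R c))
    subtree-dom c root≢0 with g (pair (unpair₁ c) 0) ≟ suc n
    ... | no ¬sel = ⊥-elim (root≢0 (sub-R-unselected c ¬sel 0))
    ... | yes sel = Xn-resp j (λ z → sym (sub-R-selected c sel (suc z)))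
                      (proj₂ (proj₂ (g∈dom (suc (suc j))) (unpair₁ c) (selected⇒root≢0 c sel)) (unpair₂ c)
                             (λ eq → root≢0 (trans (sub-R-selected c sel 0) eq)))

module UnglueBisim (P g : Baire) (n : ℕ) where
  open GluedTree P
  open UngluedTree g n

  Answer : CTree
  Answer = δCT g

  IsPath⇒Answer : ∀ σ → IsPath σ g → T Answer σ
  IsPath⇒Answer σ σ∈g = IsPath⇒nonzero σ σ∈g , inj₂ σ∈g

  Answer⇒IsPath : ∀ x σ → T Answer (x ∷ σ) → IsPath (x ∷ σ) g
  Answer⇒IsPath x σ (_ , inj₁ ())
  Answer⇒IsPath x σ (_ , inj₂ xσ∈g) = xσ∈g

  Answer⇒unglued : ∀ c σ → Selected c → T Answer (unpair₁ c ∷ unpair₂ c ∷ σ) → T (δCT R) (c ∷ σ)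
  Answer⇒unglued c σ sel node = IsPath⇒nonzero (c ∷ σ) cσ∈R , inj₂ cσ∈R
    where
    cσ∈R : IsPath (c ∷ σ) R
    cσ∈R = IsPath-R⇐ c σ sel (Answer⇒IsPath _ _ node)

  unglued⇒Answer : ∀ c σ → T (δCT R) (c ∷ σ) → Selected c × T Answer (unpair₁ c ∷ unpair₂ c ∷ σ)
  unglued⇒Answer c σ (_ , inj₁ ())
  unglued⇒Answer c σ (_ , inj₂ cσ∈R) with IsPath-R⇒ c σ cσ∈R
  ... | sel , mkσ∈g = sel , IsPath⇒Answer _ mkσ∈g

  module _ (Z : List ℕ → List ℕ → Set) (B : Bisimulation Answer (TD Glued) Z) where
    open Bisimulation B

    selected-child-related : ∀ m → T Answer [ m ] → g (pair m 0) ≡ suc n → Z [ m ] [ n ]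
    selected-child-related m m∈g labelled with forth [] [] root m m∈g
    ... | n′ , _ , z = subst (λ x → Z [ m ] [ x ]) n′≡n z
      where
      open ≡-Reasoning
      n′≡n : n′ ≡ n
      n′≡n = begin
        n′                    ≡⟨ label-child n′ ⟨
        label [ n′ ] (glue P) ≡⟨ labEq [ m ] [ n′ ] z (λ ()) ⟨
        label [ m ] g         ≡⟨ cong (_∸ 1) labelled ⟩
        n                     ∎

    grandchild-core : ∀ c → Selected c → T Answer (unpair₁ c ∷ unpair₂ c ∷ []) →
                      Σ ℕ λ j → Core (Part n) [ j ] × Z (unpair₁ c ∷ unpair₂ c ∷ []) (n ∷ j ∷ [])
    grandchild-core c sel mk∈g
      with forth [ unpair₁ c ] [ n ] (selected-child-related (unpair₁ c) (IsPath⇒Answer _ m∈g) sel) (unpair₂ c) mk∈g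
      where
      m∈g : IsPath [ unpair₁ c ] g
      m∈g = proj₁ (Answer⇒IsPath _ _ mk∈g)
    ... | j , (nj∈core , _) , z = j , Core-Glued→Part n j [] nj∈core , z

    module Nonempty (j₀ : ℕ) (j₀-core : Core (Part n) [ j₀ ]) where

      n∈core : Core Glued [ n ]
      n∈core = Core-Part→child n j₀ j₀-core

      Core-Part⇒TD-Glued : ∀ j τ → Core (Part n) (j ∷ τ) → T (TD Glued) (n ∷ j ∷ τ)
      Core-Part⇒TD-Glued j τ core = Core-Part→Glued n j τ core , n , n∈core

      related-grandchild : ∀ j → Core (Part n) [ j ] →
                           Σ ℕ λ c → Selected c × Z (unpair₁ c ∷ unpair₂ c ∷ []) (n ∷ j ∷ [])
      related-grandchild j j-core
        with back [] [] root n (n∈core , n , n∈core)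
      ... | m , m∈g , z-m with back [ m ] [ n ] z-m j (Core-Part⇒TD-Glued j [] j-core)
      ... | k , _ , z-mk =
        pair m k ,
        subst (λ x → g (pair x 0) ≡ suc n) (sym (unpair₁-pair m k)) labelled ,
        subst₂ (λ x y → Z (x ∷ y ∷ []) (n ∷ j ∷ [])) (sym (unpair₁-pair m k)) (sym (unpair₂-pair m k)) z-mk
        where
        labelled : g (pair m 0) ≡ suc n
        labelled = m∸1≡n⇒m≡1+n (Answer⇒IsPath m [] m∈g) (trans (labEq [ m ] [ n ] z-m (λ ())) (label-child n))

      Zᵤ : List ℕ → List ℕ → Set
      Zᵤ []      []      = ⊤
      Zᵤ []      (_ ∷ _) = ⊥
      Zᵤ (_ ∷ _) []      = ⊥
      Zᵤ (c ∷ σ) (j ∷ τ) = Selected c × Z (unpair₁ c ∷ unpair₂ c ∷ σ) (n ∷ j ∷ τ)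

      inTᵤ : ∀ σ τ → Zᵤ σ τ → T (δCT R) σ × T (TD (Part n)) τ
      inTᵤ [] [] _ with related-grandchild j₀ j₀-core
      ... | c , sel , z = (proj₁ (Answer⇒unglued c [] sel (proj₁ (inT _ _ z))) , inj₁ refl) ,
                          Core-child⇒Core-root j₀ j₀-core , j₀ , j₀-core
      inTᵤ (c ∷ σ) (j ∷ τ) (sel , z) with inT _ _ z
      ... | node , (core , _) = Answer⇒unglued c σ sel node , Core-Glued→Part n j τ core , j₀ , j₀-core

      lenᵤ : ∀ σ τ → Zᵤ σ τ → length σ ≡ length τ
      lenᵤ []      []      _       = refl
      lenᵤ (c ∷ σ) (j ∷ τ) (_ , z) = cong pred (len _ _ z)

      labEqᵤ : ∀ σ τ → Zᵤ σ τ → σ ≢ [] → label σ R ≡ label τ (sub P n)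
      labEqᵤ []      []      _         σ≢[] = ⊥-elim (σ≢[] refl)
      labEqᵤ (c ∷ σ) (j ∷ τ) (sel , z) _    =
        trans (label-R c σ sel) (trans (labEq _ _ z (λ ())) (label-Glued n j τ))

      forthᵤ : ∀ σ τ → Zᵤ σ τ → ∀ d → T (δCT R) (σ ++ [ d ]) →
               Σ ℕ (λ e → T (TD (Part n)) (τ ++ [ e ]) × Zᵤ (σ ++ [ d ]) (τ ++ [ e ]))
      forthᵤ [] [] _ d d∈R with unglued⇒Answer d [] d∈R
      ... | sel , node with grandchild-core d sel node
      ... | j , j-core , z = j , (j-core , j₀ , j₀-core) , sel , z
      forthᵤ (c ∷ σ) (j ∷ τ) (sel , z) d node with unglued⇒Answer c (σ ++ [ d ]) node
      ... | _ , node′ with forth _ _ z d node′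
      ... | e , (core , _) , z′ = e , (Core-Glued→Part n j (τ ++ [ e ]) core , j₀ , j₀-core) , sel , z′

      backᵤ : ∀ σ τ → Zᵤ σ τ → ∀ e → T (TD (Part n)) (τ ++ [ e ]) →
              Σ ℕ (λ d → T (δCT R) (σ ++ [ d ]) × Zᵤ (σ ++ [ d ]) (τ ++ [ e ]))
      backᵤ [] [] _ e (e-core , _) with related-grandchild e e-core
      ... | c , sel , z = c , Answer⇒unglued c [] sel (proj₁ (inT _ _ z)) , sel , z
      backᵤ (c ∷ σ) (j ∷ τ) (sel , z) e (core , _) with back _ _ z e (Core-Part⇒TD-Glued j (τ ++ [ e ]) core)
      ... | d , node , z′ = d , Answer⇒unglued c (σ ++ [ d ]) sel node , sel , z′

      unglued-bisim : Bisim (δCT R) (TD (Part n))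
      unglued-bisim = inj₂ (Zᵤ , record
        { inT = inTᵤ ; root = tt ; len = lenᵤ ; labEq = labEqᵤ ; forth = forthᵤ ; back = backᵤ })

    module EmptyPart (empty : EmptyT (TD (Part n))) (g∈dom : DomCT g) where

      entry≡0 : ∀ c z → unglueEntry g n c z ≡ 0
      entry≡0 c z with g (pair (unpair₁ c) 0) ≟ suc n
      ... | no ¬sel = ifEqual-≢ _ ¬sel
      ... | yes sel with Grandchild c 0 ≟ 0
      ...   | yes root≡0 = trans (ifEqual-≡ _ sel)
                             (proj₂ (g∈dom 1) (unpair₁ c) (selected⇒root≢0 c sel) (unpair₂ c) root≡0 z)
      ...   | no root≢0 with grandchild-core c sel (IsPath⇒Answer _ (selected⇒root≢0 c sel , root≢0))
      ...     | j , j-core , _ = ⊥-elim (empty [ j ] (j-core , j , j-core))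

      unglued-bisim : Bisim (δCT R) (TD (Part n))
      unglued-bisim = inj₁ ((λ σ σ∈R → proj₁ σ∈R (λ x → trans (R-entry x) (entry≡0 (unpair₁ x) (unpair₂ x)))) , empty)

  module EmptyAnswer (Answer-empty : EmptyT Answer) (TD-Glued-empty : EmptyT (TD Glued)) where

    g≡0 : IsZero g
    g≡0 x with g x ≟ 0
    ... | yes gx≡0 = gx≡0
    ... | no  gx≢0 = ⊥-elim (Answer-empty [] ((λ g≡0 → gx≢0 (g≡0 x)) , inj₁ refl))

    unglued-bisim : Bisim (δCT R) (TD (Part n))
    unglued-bisim = inj₁ (R-empty , TD-Part-empty)
      where
      R-empty : EmptyT (δCT R)
      R-empty σ (R≢0 , _) =
        R≢0 λ x → trans (R-entry x) (ifEqual-≢ _ λ eq → 0≢1+n (trans (sym (g≡0 _)) eq))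
      TD-Part-empty : EmptyT (TD (Part n))
      TD-Part-empty σ (_ , j , j-core) = TD-Glued-empty [ n ] (n∈core , n , n∈core)
        where
        n∈core : Core Glued [ n ]
        n∈core = Core-Part→child n j j-core

  unglued-bisim : DomCT g → Bisim Answer (TD Glued) →
                  EmptyT (TD (Part n)) ⊎ Σ ℕ (λ j → Core (Part n) [ j ]) →
                  Bisim (δCT R) (TD (Part n))
  unglued-bisim _     (inj₁ (Answer-empty , TD-Glued-empty)) _ =
    EmptyAnswer.unglued-bisim Answer-empty TD-Glued-empty
  unglued-bisim g∈dom (inj₂ (Z , B)) (inj₁ TD-Part-empty)  = EmptyPart.unglued-bisim Z B TD-Part-empty g∈dom
  unglued-bisim _     (inj₂ (Z , B)) (inj₂ (j₀ , j₀-core)) = Nonempty.unglued-bisim Z B j₀ j₀-core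

TDhat≤sWTDprob : TDhat ≤sW TDprob
TDhat≤sWTDprob = record
  { forward             = glue
  ; backward            = unglue
  ; forward-computable  = glueᶜ
  ; backward-computable = unglueᶜ
  ; backward-resp       = unglue-resp
  ; forward-dom         = glue-dom
  ; backward-sol        = unglue-solves }
  where
  unglue-solves : ∀ G → Realizes TDprob G → ∀ P → (∀ n → DomCT (sub P n)) → Sol TDhat P (unglue (G (glue P)))
  unglue-solves G realizes P P∈dom n with realizes (glue P) (glue-dom P P∈dom)
  ... | g∈dom , g∼TD-Glued =
    UngluedTree.R-dom answer n g∈dom , UnglueBisim.unglued-bisim P answer n g∈dom g∼TD-Glued TD-Part-decided
    where
    answer : Baire
    answer = G (glue P)
    -- Whether TD of the n-th tree is empty cannot be read off g; the realizer run on that tree decides it.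
    TD-Part-decided : EmptyT (TD (δCT (sub P n))) ⊎ Σ ℕ (λ j → Core (δCT (sub P n)) [ j ])
    TD-Part-decided = Bisim-decides-TD (proj₂ (realizes (sub P n) (P∈dom n)))

mainTheorem6 : TDprob ≡W TDhat
mainTheorem6 = ≤sW⇒≤W TDprob≤sWTDhat , ≤sW⇒≤W TDhat≤sWTDprob
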